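{- Consider words over the alphabet $\{U,D,R\}$, where $U=(1,1)$, and $D$ and $R$ both denote the step $(1,-1)$. Call such a word an admissible skew path if the lattice path it describes, starting at $(0,0)$, never goes below the $x$-axis, the word contains no factor $UR$ and no factor $RU$, and every maximal run of consecutive steps from $\{D,R\}$ that ends on the $x$-axis has odd length. Then the generating function of all admissible skew paths (including the empty path), with $z$ marking the number of steps and regardless of the final level, equals $$\frac{z(2z^3+9z^2+4z-7)+(z+2)(2z+1)\sqrt{1-6z^2+5z^4}}{2(1+z^2)(1-2z-z^2)}=1+z+2z^2+3z^3+5z^4+10z^5+20z^6+\cdots.$$
   Context: Here $R$ is a red down-step representing the south-west step of skew Dyck paths; the forbidden factors $UR$, $RU$ encode the no-overlap condition, and the parity condition is Stanley's restriction on down-runs (of either colour) to the $x$-axis. -}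

module Defs where

open import Data.Bool using (Bool; true; false; _∧_; not; if_then_else_)
open import Data.Nat as ℕ using (ℕ; zero; suc; _∸_)
open import Data.Integer as ℤ using (ℤ; +_; -[1+_])
open import Data.Rational as ℚ using (ℚ; 0ℚ; 1ℚ; ½; _+_; _*_; _-_; NonZero; 1/_)
open import Data.List using (List; []; _∷_; _++_; [_]; length; filter; map; concatMap; upTo; foldr)
open import Relation.Nullary.Decidable using (Dec; yes; no)
open import Data.Bool using (T)
open import Relation.Nullary.Decidable using (T?)

-- Words over {U, D, R}; U = (1,1), D = R = (1,-1).

data Step : Set where
  U D R : Step

words : ℕ → List (List Step)
words zero    = [] ∷ []
words (suc n) = concatMap (λ w → (U ∷ w) ∷ (D ∷ w) ∷ (R ∷ w) ∷ []) (words n)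

noForbidden : List Step → Bool
noForbidden (U ∷ R ∷ _) = false
noForbidden (R ∷ U ∷ _) = false
noForbidden (_ ∷ w)     = noForbidden w
noForbidden []          = true

isZero : ℕ → Bool
isZero zero    = true
isZero (suc _) = false

isEven : ℕ → Bool
isEven zero          = true
isEven (suc zero)    = false
isEven (suc (suc n)) = isEven n

badRun : (h r : ℕ) → Bool
badRun h zero    = false
badRun h (suc r) = isZero h ∧ isEven (suc r)

-- walk h r w : the path read so far is at height h and its final
-- maximal down-run (so far) has length r; checks the remaining word w
-- never goes below the x-axis and every maximal down-run ending on the
-- x-axis has odd length.
walk : (h r : ℕ) → List Step → Bool
walk h r []      = not (badRun h r)
walk h r (U ∷ w) = not (badRun h r) ∧ walk (suc h) zero w
walk zero    r (D ∷ w) = false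
walk (suc h) r (D ∷ w) = walk h (suc r) w
walk zero    r (R ∷ w) = false
walk (suc h) r (R ∷ w) = walk h (suc r) w

admissible : List Step → Bool
admissible w = walk zero zero w ∧ noForbidden w

count : ℕ → ℕ
count n = length (filter (λ w → T? (admissible w)) (words n))

FPS : Set
FPS = ℕ → ℚ

at : List ℚ → ℕ → ℚ
at []       _       = 0ℚ
at (x ∷ xs) zero    = x
at (x ∷ xs) (suc n) = at xs n

-- polynomial with integer coefficients [a₀, a₁, ...]
poly : List ℤ → FPS
poly cs = at (map (λ c → c ℚ./ 1) cs)

sumTo : ℕ → (ℕ → ℚ) → ℚ
sumTo zero    f = f zero
sumTo (suc n) f = sumTo n f + f (suc n)

sumFrom1 : ℕ → (ℕ → ℚ) → ℚ
sumFrom1 zero    f = 0ℚ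
sumFrom1 (suc n) f = sumFrom1 n f + f (suc n)

_⊕_ : FPS → FPS → FPS
(f ⊕ g) n = f n + g n

_⊗_ : FPS → FPS → FPS
(f ⊗ g) n = sumTo n (λ i → f i * g (n ∸ i))

infixl 6 _⊕_
infixl 7 _⊗_

-- Quotient a / b of power series when b₀ ≠ 0:
-- q_n = (a_n - Σ_{i=1}^{n} b_i q_{n-i}) / b₀.
divL : (a b : FPS) → .{{NonZero (b 0)}} → ℕ → List ℚ   -- [q_n, ..., q_0]
divL a b zero    = [ a 0 * 1/ (b 0) ]
divL a b (suc n) =
  let qs = divL a b n in
  ((a (suc n) - sumFrom1 (suc n) (λ i → b i * at qs (i ∸ 1))) * 1/ (b 0)) ∷ qs

divS : (a b : FPS) → .{{NonZero (b 0)}} → FPS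
divS a b n = at (divL a b n) 0

-- Square root of a power series c with c₀ = 1: the unique series s
-- with s₀ = 1 and s² = c, i.e. s_n = (c_n - Σ_{i=1}^{n-1} s_i s_{n-i}) / 2.
sqrtL : FPS → ℕ → List ℚ   -- [s_0, ..., s_n]
sqrtL c zero    = [ 1ℚ ]
sqrtL c (suc n) =
  let ss = sqrtL c n in
  ss ++ [ (c (suc n) - sumFrom1 n (λ i → at ss i * at ss (suc n ∸ i))) * ½ ]

sqrtS : FPS → FPS
sqrtS c n = at (sqrtL c n) n

countS : FPS
countS n = (+ count n) ℚ./ 1

z : FPS
z = poly (+ 0 ∷ + 1 ∷ [])

-- z (2z³ + 9z² + 4z - 7) + (z + 2)(2z + 1) √(1 - 6z² + 5z⁴)
numer : FPS
numer = z ⊗ poly (-[1+ 6 ] ∷ + 4 ∷ + 9 ∷ + 2 ∷ [])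
      ⊕ poly (+ 2 ∷ + 1 ∷ []) ⊗ poly (+ 1 ∷ + 2 ∷ [])
          ⊗ sqrtS (poly (+ 1 ∷ + 0 ∷ -[1+ 5 ] ∷ + 0 ∷ + 5 ∷ []))

-- 2 (1 + z²)(1 - 2z - z²)
denom : FPS
denom = poly (+ 2 ∷ []) ⊗ poly (+ 1 ∷ + 0 ∷ + 1 ∷ [])
      ⊗ poly (+ 1 ∷ -[1+ 1 ] ∷ -[1+ 0 ] ∷ [])

rhs : FPS
rhs = divS numer denom

module Submission where

-- The local conditions are recognised by an automaton whose state records
-- the last step and the parity of the current down-run.  Cutting a path at
-- its first return to the ground, and expanding first passages by their
-- first step, turns the generating functions into a polynomial system over
-- ℚ[[z]].  In it the colour of the last step of a first passage does not
-- matter, and the series X of first passages from height 1 (just after an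
-- up step) that end with a black step satisfies
-- z X² + (z² − 1) X + z − z³ = 0, so 1 − z² − 2 z X is the square root of
-- 1 − 6 z² + 5 z⁴.  Eliminating the other unknowns writes the series of
-- admissible paths as a rational function of z and X, which is the stated
-- closed form; each elimination step cancels a factor with nonzero constant
-- term.

open import Defs
open import Algebra.Bundles using (CommutativeRing; CommutativeSemiring)
open import Data.Bool as Bool using (Bool; true; false; _∧_; not)
open import Data.Integer as ℤ using (ℤ)
open import Data.List using (List; []; _∷_; null)
open import Data.Maybe using (Maybe; just; nothing; maybe′)
open import Data.Nat as ℕ using (ℕ; zero; suc)
import Data.Rational as ℚ
import Data.Rational.Properties as ℚ
open import Function using (_∘_)
open import Relation.Binary.PropositionalEquality as ≡ using (_≡_; _≗_)
open import Relation.Nullary.Decidable using (yes; no; does)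

module Sums {c ℓ} (S : CommutativeSemiring c ℓ) where

  open import Level using (Level)
  open CommutativeSemiring S
  open import Algebra.Properties.CommutativeSemigroup +-commutativeSemigroup using (interchange)

  private variable
    a b : Level
    A B : Set a

  ∑ : List A → (A → Carrier) → Carrier
  ∑ []       f = 0#
  ∑ (x ∷ xs) f = f x + ∑ xs f

  ∑-cong : ∀ xs {f g : A → Carrier} → (∀ x → f x ≈ g x) → ∑ xs f ≈ ∑ xs g
  ∑-cong []       f≈g = refl
  ∑-cong (x ∷ xs) f≈g = +-cong (f≈g x) (∑-cong xs f≈g)

  ∑-zero : (xs : List A) → ∑ xs (λ _ → 0#) ≈ 0#
  ∑-zero []       = refl
  ∑-zero (x ∷ xs) = trans (+-identityˡ _) (∑-zero xs)

  ∑-+ : ∀ xs (f g : A → Carrier) → ∑ xs (λ x → f x + g x) ≈ ∑ xs f + ∑ xs g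
  ∑-+ []       f g = sym (+-identityˡ 0#)
  ∑-+ (x ∷ xs) f g = trans (+-congˡ (∑-+ xs f g)) (interchange (f x) (g x) (∑ xs f) (∑ xs g))

  ∑-*ˡ : ∀ xs y (f : A → Carrier) → y * ∑ xs f ≈ ∑ xs (λ x → y * f x)
  ∑-*ˡ []       y f = zeroʳ y
  ∑-*ˡ (x ∷ xs) y f = trans (distribˡ y (f x) (∑ xs f)) (+-congˡ (∑-*ˡ xs y f))

  ∑-*ʳ : ∀ xs y (f : A → Carrier) → ∑ xs f * y ≈ ∑ xs (λ x → f x * y)
  ∑-*ʳ xs y f = trans (*-comm (∑ xs f) y) (trans (∑-*ˡ xs y f) (∑-cong xs (λ x → *-comm y (f x))))

  ∑-comm : ∀ xs (ys : List B) (f : A → B → Carrier) →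
           ∑ xs (λ x → ∑ ys (f x)) ≈ ∑ ys (λ y → ∑ xs (λ x → f x y))
  ∑-comm []       ys f = sym (∑-zero ys)
  ∑-comm (x ∷ xs) ys f = trans (+-congˡ (∑-comm xs ys f)) (sym (∑-+ ys (f x) _))

module PowerSeries where

  open import Algebra.Structures using (IsAbelianGroup)
  import Algebra.Consequences.Setoid as Consequences
  import Algebra.Solver.Ring
  open import Algebra.Solver.Ring.AlmostCommutativeRing using (fromCommutativeRing; _-Raw-AlmostCommutative⟶_)
  open import Data.List using (_++_; [_]; length)
  open import Data.List.Properties using (length-++)
  open import Data.Nat using (_∸_; _≤_; z≤n; s≤s)
  import Data.Nat.Properties as ℕ
  open import Data.Product using (_,_)
  open import Data.Rational using (ℚ; 0ℚ; 1ℚ; ½; _+_; _*_; -_; _-_)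
  open import Data.Rational.Solver using () renaming (module +-*-Solver to ℚ-Solver)
  open import Data.Sum using (inj₁; inj₂)
  open import Level using (0ℓ)
  open import Relation.Binary.Bundles using (Setoid)
  open import Relation.Binary.Definitions using (WeaklyDecidable)
  open ≡ using (refl; sym; trans; cong; cong₂; subst; module ≡-Reasoning; _→-setoid_)
  open import Algebra.Properties.CommutativeSemigroup
    (CommutativeRing.+-commutativeSemigroup ℚ.+-*-commutativeRing) using (interchange)

  tail : FPS → FPS
  tail f n = f (suc n)

  const : ℚ → FPS
  const q zero    = q
  const q (suc _) = 0ℚ

  -- Zero is const 0ℚ rather than λ _ → 0ℚ so that it is the image of 0ℚ
  -- under the coefficient map of the ring solver.
  0S 1S : FPS
  0S = const 0ℚ
  1S = const 1ℚ

  0S≡0 : ∀ n → 0S n ≡ 0ℚ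
  0S≡0 zero    = refl
  0S≡0 (suc n) = refl

  ⊖_ : FPS → FPS
  (⊖ f) n = - f n

  sumTo-cong : ∀ n {f g : ℕ → ℚ} → (∀ i → i ≤ n → f i ≡ g i) → sumTo n f ≡ sumTo n g
  sumTo-cong zero    f≡g = f≡g 0 z≤n
  sumTo-cong (suc n) f≡g =
    cong₂ _+_ (sumTo-cong n (λ i i≤n → f≡g i (ℕ.m≤n⇒m≤1+n i≤n))) (f≡g (suc n) ℕ.≤-refl)

  sumTo-zero : ∀ n {f : ℕ → ℚ} → (∀ i → f i ≡ 0ℚ) → sumTo n f ≡ 0ℚ
  sumTo-zero zero    f≡0 = f≡0 0
  sumTo-zero (suc n) f≡0 = cong₂ _+_ (sumTo-zero n f≡0) (f≡0 (suc n))

  sumTo-+ : ∀ n (f g : ℕ → ℚ) → sumTo n (λ i → f i + g i) ≡ sumTo n f + sumTo n g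
  sumTo-+ zero    f g = refl
  sumTo-+ (suc n) f g = trans (cong (_+ (f (suc n) + g (suc n))) (sumTo-+ n f g))
                              (interchange (sumTo n f) (sumTo n g) (f (suc n)) (g (suc n)))

  *-distribˡ-sumTo : ∀ n c (f : ℕ → ℚ) → c * sumTo n f ≡ sumTo n (λ i → c * f i)
  *-distribˡ-sumTo zero    c f = refl
  *-distribˡ-sumTo (suc n) c f =
    trans (ℚ.*-distribˡ-+ c (sumTo n f) (f (suc n))) (cong (_+ c * f (suc n)) (*-distribˡ-sumTo n c f))

  sumTo-split-first : ∀ n (f : ℕ → ℚ) → sumTo (suc n) f ≡ f 0 + sumTo n (f ∘ suc)
  sumTo-split-first zero    f = refl
  sumTo-split-first (suc n) f =
    trans (cong (_+ f (suc (suc n))) (sumTo-split-first n f)) (ℚ.+-assoc (f 0) _ _)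

  ⊗-cong : ∀ {f f′ g g′} → f ≗ f′ → g ≗ g′ → f ⊗ g ≗ f′ ⊗ g′
  ⊗-cong f≗f′ g≗g′ n = sumTo-cong n (λ i _ → cong₂ _*_ (f≗f′ i) (g≗g′ (n ∸ i)))

  ⊗-congˡ : ∀ f {g g′} → g ≗ g′ → f ⊗ g ≗ f ⊗ g′
  ⊗-congˡ f = ⊗-cong {f} (λ _ → refl)

  ⊗-congʳ : ∀ {f f′} g → f ≗ f′ → f ⊗ g ≗ f′ ⊗ g
  ⊗-congʳ g f≗f′ = ⊗-cong {g = g} f≗f′ (λ _ → refl)

  ⊗-split-first : ∀ f g n → (f ⊗ g) (suc n) ≡ f 0 * g (suc n) + (tail f ⊗ g) n
  ⊗-split-first f g n = sumTo-split-first n _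

  ⊗-split-last : ∀ f g n → (f ⊗ g) (suc n) ≡ (f ⊗ tail g) n + f (suc n) * g 0
  ⊗-split-last f g n =
    cong₂ _+_ (sumTo-cong n (λ i i≤n → cong (λ k → f i * g k) (ℕ.+-∸-assoc 1 i≤n)))
              (cong (λ k → f (suc n) * g k) (ℕ.n∸n≡0 n))

  ⊗-comm : ∀ f g → f ⊗ g ≗ g ⊗ f
  ⊗-comm f g zero    = ℚ.*-comm (f 0) (g 0)
  ⊗-comm f g (suc n) = begin
    (f ⊗ g) (suc n)                   ≡⟨ ⊗-split-last f g n ⟩
    (f ⊗ tail g) n + f (suc n) * g 0  ≡⟨ cong₂ _+_ (⊗-comm f (tail g) n) (ℚ.*-comm (f (suc n)) (g 0)) ⟩
    (tail g ⊗ f) n + g 0 * f (suc n)  ≡⟨ ℚ.+-comm ((tail g ⊗ f) n) _ ⟩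
    g 0 * f (suc n) + (tail g ⊗ f) n  ≡⟨ ⊗-split-first g f n ⟨
    (g ⊗ f) (suc n)                   ∎
    where open ≡-Reasoning

  ⊗-distribˡ-⊕ : ∀ f g h → f ⊗ (g ⊕ h) ≗ f ⊗ g ⊕ f ⊗ h
  ⊗-distribˡ-⊕ f g h n =
    trans (sumTo-cong n (λ i _ → ℚ.*-distribˡ-+ (f i) (g (n ∸ i)) (h (n ∸ i)))) (sumTo-+ n _ _)

  ⊗-null : ∀ f g → (∀ i → f i ≡ 0ℚ) → ∀ n → (f ⊗ g) n ≡ 0ℚ
  ⊗-null f g f≡0 n = sumTo-zero n (λ i → trans (cong (_* g (n ∸ i)) (f≡0 i)) (ℚ.*-zeroˡ (g (n ∸ i))))

  ⊗-zeroˡ : ∀ f → 0S ⊗ f ≗ 0S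
  ⊗-zeroˡ f n = trans (⊗-null 0S f 0S≡0 n) (sym (0S≡0 n))

  ⊗-identityˡ : ∀ f → 1S ⊗ f ≗ f
  ⊗-identityˡ f zero    = ℚ.*-identityˡ (f 0)
  ⊗-identityˡ f (suc n) = begin
    (1S ⊗ f) (suc n)                    ≡⟨ ⊗-split-first 1S f n ⟩
    1ℚ * f (suc n) + (tail 1S ⊗ f) n
      ≡⟨ cong₂ _+_ (ℚ.*-identityˡ (f (suc n))) (⊗-null (tail 1S) f (λ _ → refl) n) ⟩
    f (suc n) + 0ℚ                      ≡⟨ ℚ.+-identityʳ (f (suc n)) ⟩
    f (suc n)                           ∎
    where open ≡-Reasoning

  ⊗-scaleʳ : ∀ f g c n → (f ⊗ (λ i → g i * c)) n ≡ (f ⊗ g) n * c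
  ⊗-scaleʳ f g c n = begin
    sumTo n (λ i → f i * (g (n ∸ i) * c))  ≡⟨ sumTo-cong n (λ i _ → ℚ.*-assoc (f i) _ c) ⟨
    sumTo n (λ i → f i * g (n ∸ i) * c)    ≡⟨ sumTo-cong n (λ i _ → ℚ.*-comm _ c) ⟩
    sumTo n (λ i → c * (f i * g (n ∸ i)))  ≡⟨ *-distribˡ-sumTo n c _ ⟨
    c * (f ⊗ g) n                          ≡⟨ ℚ.*-comm c _ ⟩
    (f ⊗ g) n * c                          ∎
    where open ≡-Reasoning

  ⊗-assoc : ∀ f g h → (f ⊗ g) ⊗ h ≗ f ⊗ (g ⊗ h)
  ⊗-assoc f g h zero    = ℚ.*-assoc (f 0) (g 0) (h 0)
  ⊗-assoc f g h (suc n) = begin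
    ((f ⊗ g) ⊗ h) (suc n)
      ≡⟨ ⊗-split-last (f ⊗ g) h n ⟩
    ((f ⊗ g) ⊗ tail h) n + (f ⊗ g) (suc n) * h 0
      ≡⟨ cong₂ _+_ (⊗-assoc f g (tail h) n) (cong (_* h 0) (⊗-split-last f g n)) ⟩
    (f ⊗ (g ⊗ tail h)) n + ((f ⊗ tail g) n + f (suc n) * g 0) * h 0
      ≡⟨ regroup ((f ⊗ (g ⊗ tail h)) n) ((f ⊗ tail g) n) (f (suc n)) ⟩
    ((f ⊗ (g ⊗ tail h)) n + (f ⊗ tail g) n * h 0) + f (suc n) * (g 0 * h 0)
      ≡⟨ cong (_+ f (suc n) * (g 0 * h 0)) tail-of-product ⟩
    (f ⊗ tail (g ⊗ h)) n + f (suc n) * (g ⊗ h) 0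
      ≡⟨ ⊗-split-last f (g ⊗ h) n ⟨
    (f ⊗ (g ⊗ h)) (suc n) ∎
    where
    open ≡-Reasoning
    regroup : ∀ a b c → a + (b + c * g 0) * h 0 ≡ (a + b * h 0) + c * (g 0 * h 0)
    regroup a b c = begin
      a + (b + c * g 0) * h 0             ≡⟨ cong (a +_) (ℚ.*-distribʳ-+ (h 0) b (c * g 0)) ⟩
      a + (b * h 0 + c * g 0 * h 0)       ≡⟨ cong (λ x → a + (b * h 0 + x)) (ℚ.*-assoc c (g 0) (h 0)) ⟩
      a + (b * h 0 + c * (g 0 * h 0))     ≡⟨ ℚ.+-assoc a (b * h 0) _ ⟨
      (a + b * h 0) + c * (g 0 * h 0)     ∎
    tail-of-product : (f ⊗ (g ⊗ tail h)) n + (f ⊗ tail g) n * h 0 ≡ (f ⊗ tail (g ⊗ h)) n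
    tail-of-product = sym (begin
      (f ⊗ tail (g ⊗ h)) n
        ≡⟨ ⊗-cong {f} (λ _ → refl) (⊗-split-last g h) n ⟩
      (f ⊗ (g ⊗ tail h ⊕ (λ i → tail g i * h 0))) n
        ≡⟨ ⊗-distribˡ-⊕ f (g ⊗ tail h) (λ i → tail g i * h 0) n ⟩
      (f ⊗ (g ⊗ tail h)) n + (f ⊗ (λ i → tail g i * h 0)) n
        ≡⟨ cong ((f ⊗ (g ⊗ tail h)) n +_) (⊗-scaleʳ f (tail g) (h 0) n) ⟩
      (f ⊗ (g ⊗ tail h)) n + (f ⊗ tail g) n * h 0 ∎)

  ⊕-isAbelianGroup : IsAbelianGroup _≗_ _⊕_ 0S ⊖_
  ⊕-isAbelianGroup = record
    { isGroup = record
      { isMonoid = record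
        { isSemigroup = record
          { isMagma = record
            { isEquivalence = Setoid.isEquivalence (ℕ →-setoid ℚ)
            ; ∙-cong = λ f≗f′ g≗g′ n → cong₂ _+_ (f≗f′ n) (g≗g′ n)
            }
          ; assoc = λ f g h n → ℚ.+-assoc (f n) (g n) (h n)
          }
        ; identity = (λ f n → trans (cong (_+ f n) (0S≡0 n)) (ℚ.+-identityˡ (f n)))
                   , (λ f n → trans (cong (f n +_) (0S≡0 n)) (ℚ.+-identityʳ (f n)))
        }
      ; inverse = (λ f n → trans (ℚ.+-inverseˡ (f n)) (sym (0S≡0 n)))
                , (λ f n → trans (ℚ.+-inverseʳ (f n)) (sym (0S≡0 n)))
      ; ⁻¹-cong = λ f≗g n → cong -_ (f≗g n)
      }
    ; comm = λ f g n → ℚ.+-comm (f n) (g n)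
    }

  FPS-commutativeRing : CommutativeRing 0ℓ 0ℓ
  FPS-commutativeRing = record
    { Carrier = FPS
    ; _≈_ = _≗_
    ; _+_ = _⊕_
    ; _*_ = _⊗_
    ; -_ = ⊖_
    ; 0# = 0S
    ; 1# = 1S
    ; isCommutativeRing = record
      { isRing = record
        { +-isAbelianGroup = ⊕-isAbelianGroup
        ; *-cong = ⊗-cong
        ; *-assoc = ⊗-assoc
        ; *-identity = comm∧idˡ⇒id {_∙_ = _⊗_} ⊗-comm {e = 1S} ⊗-identityˡ
        ; distrib = comm∧distrˡ⇒distr (λ p q n → cong₂ _+_ (p n) (q n)) ⊗-comm ⊗-distribˡ-⊕
        }
      ; *-comm = ⊗-comm
      }
    }
    where open Consequences (ℕ →-setoid ℚ)

  const-+ : ∀ a b → const (a + b) ≗ const a ⊕ const b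
  const-+ a b zero    = refl
  const-+ a b (suc n) = sym (ℚ.+-identityʳ 0ℚ)

  const-⊗ : ∀ a f → const a ⊗ f ≗ (λ n → a * f n)
  const-⊗ a f zero    = refl
  const-⊗ a f (suc n) = begin
    (const a ⊗ f) (suc n)                     ≡⟨ ⊗-split-first (const a) f n ⟩
    a * f (suc n) + (tail (const a) ⊗ f) n
      ≡⟨ cong (a * f (suc n) +_) (⊗-null (tail (const a)) f (λ _ → refl) n) ⟩
    a * f (suc n) + 0ℚ                        ≡⟨ ℚ.+-identityʳ _ ⟩
    a * f (suc n)                             ∎
    where open ≡-Reasoning

  const-* : ∀ a b → const (a * b) ≗ const a ⊗ const b
  const-* a b n = sym (trans (const-⊗ a (const b) n) (scaled n))
    where
    scaled : ∀ n → a * const b n ≡ const (a * b) n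
    scaled zero    = refl
    scaled (suc n) = ℚ.*-zeroʳ a

  const-morphism : ℚ.+-*-rawRing -Raw-AlmostCommutative⟶ fromCommutativeRing FPS-commutativeRing
  const-morphism = record
    { ⟦_⟧    = const
    ; +-homo = const-+
    ; *-homo = const-*
    ; -‿homo = λ { a zero → refl ; a (suc n) → refl }
    ; 0-homo = λ { zero → refl ; (suc n) → refl }
    ; 1-homo = λ _ → refl
    }

  const-≟ : WeaklyDecidable (λ a b → const a ≗ const b)
  const-≟ a b with a ℚ.≟ b
  ... | yes refl = just (λ _ → refl)
  ... | no  _    = nothing

  module FPS-Solver =
    Algebra.Solver.Ring ℚ.+-*-rawRing (fromCommutativeRing FPS-commutativeRing) const-morphism const-≟

  z⊗-zero : ∀ f → (z ⊗ f) 0 ≡ 0ℚ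
  z⊗-zero f = ℚ.*-zeroˡ (f 0)

  z⊗-suc : ∀ f n → (z ⊗ f) (suc n) ≡ f n
  z⊗-suc f n = begin
    (z ⊗ f) (suc n)                    ≡⟨ ⊗-split-first z f n ⟩
    0ℚ * f (suc n) + (tail z ⊗ f) n    ≡⟨ cong₂ _+_ (ℚ.*-zeroˡ (f (suc n))) (⊗-congʳ f tail-z n) ⟩
    0ℚ + (1S ⊗ f) n                    ≡⟨ ℚ.+-identityˡ _ ⟩
    (1S ⊗ f) n                         ≡⟨ ⊗-identityˡ f n ⟩
    f n                                ∎
    where
    open ≡-Reasoning
    tail-z : tail z ≗ 1S
    tail-z zero    = refl
    tail-z (suc _) = refl

  head-tail : ∀ {f c g} → f 0 ≡ c → tail f ≗ g → f ≗ const c ⊕ z ⊗ g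
  head-tail {c = c} {g} f0≡c _    zero    =
    trans f0≡c (sym (trans (cong (c +_) (z⊗-zero g)) (ℚ.+-identityʳ c)))
  head-tail {g = g} _    tf≗g (suc n) = trans (tf≗g n) (sym (trans (ℚ.+-identityˡ _) (z⊗-suc g n)))

  *-cancelˡ-0 : ∀ u .{{_ : ℚ.NonZero u}} d → u * d ≡ 0ℚ → d ≡ 0ℚ
  *-cancelˡ-0 u d ud≡0 = begin
    d                 ≡⟨ ℚ.*-identityˡ d ⟨
    1ℚ * d            ≡⟨ cong (_* d) (ℚ.*-inverseˡ u) ⟨
    ℚ.1/ u * u * d    ≡⟨ ℚ.*-assoc (ℚ.1/ u) u d ⟩
    ℚ.1/ u * (u * d)  ≡⟨ cong (ℚ.1/ u *_) ud≡0 ⟩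
    ℚ.1/ u * 0ℚ       ≡⟨ ℚ.*-zeroʳ (ℚ.1/ u) ⟩
    0ℚ                ∎
    where open ≡-Reasoning

  ⊗-zero-cancelˡ : ∀ u {q} .{{_ : ℚ.NonZero q}} → u 0 ≡ q → ∀ d → u ⊗ d ≗ 0S → d ≗ 0S
  ⊗-zero-cancelˡ u {q} u0≡q d ud≗0 zero    =
    *-cancelˡ-0 q (d 0) (trans (cong (_* d 0) (sym u0≡q)) (ud≗0 0))
  ⊗-zero-cancelˡ u {q} u0≡q d ud≗0 (suc n) =
    trans (⊗-zero-cancelˡ u u0≡q (tail d) u·tail-d≗0 n) (0S≡0 n)
    where
    d0≡0 : d 0 ≡ 0ℚ
    d0≡0 = ⊗-zero-cancelˡ u u0≡q d ud≗0 0
    u·tail-d≗0 : u ⊗ tail d ≗ 0S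
    u·tail-d≗0 m = begin
      (u ⊗ tail d) m                      ≡⟨ ℚ.+-identityʳ _ ⟨
      (u ⊗ tail d) m + 0ℚ                 ≡⟨ cong (λ x → (u ⊗ tail d) m + x) (ℚ.*-zeroʳ (u (suc m))) ⟨
      (u ⊗ tail d) m + u (suc m) * 0ℚ     ≡⟨ cong (λ x → (u ⊗ tail d) m + u (suc m) * x) d0≡0 ⟨
      (u ⊗ tail d) m + u (suc m) * d 0    ≡⟨ ⊗-split-last u d m ⟨
      (u ⊗ d) (suc m)                     ≡⟨ ud≗0 (suc m) ⟩
      0ℚ                                  ≡⟨ 0S≡0 m ⟨
      0S m                                ∎
      where open ≡-Reasoning

  sumFrom1-cong : ∀ n {f g : ℕ → ℚ} → (∀ i → 1 ≤ i → i ≤ n → f i ≡ g i) → sumFrom1 n f ≡ sumFrom1 n g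
  sumFrom1-cong zero    f≡g = refl
  sumFrom1-cong (suc n) f≡g =
    cong₂ _+_ (sumFrom1-cong n (λ i 1≤i i≤n → f≡g i 1≤i (ℕ.m≤n⇒m≤1+n i≤n)))
              (f≡g (suc n) (s≤s z≤n) ℕ.≤-refl)

  sumTo-suc : ∀ n (f : ℕ → ℚ) → sumTo n (f ∘ suc) ≡ sumFrom1 (suc n) f
  sumTo-suc zero    f = sym (ℚ.+-identityˡ (f 1))
  sumTo-suc (suc n) f = cong (_+ f (suc (suc n))) (sumTo-suc n f)

  sumTo-sumFrom1 : ∀ n (f : ℕ → ℚ) → sumTo n f ≡ f 0 + sumFrom1 n f
  sumTo-sumFrom1 zero    f = sym (ℚ.+-identityʳ (f 0))
  sumTo-sumFrom1 (suc n) f = trans (cong (_+ f (suc n)) (sumTo-sumFrom1 n f)) (ℚ.+-assoc (f 0) _ _)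

  divL-at : ∀ a b .{{_ : ℚ.NonZero (b 0)}} n j → j ≤ n → at (divL a b n) j ≡ divS a b (n ∸ j)
  divL-at a b zero    zero    _         = refl
  divL-at a b (suc n) zero    _         = refl
  divL-at a b (suc n) (suc j) (s≤s j≤n) = divL-at a b n j j≤n

  private
    *-cancel-1/ : ∀ b .{{_ : ℚ.NonZero b}} x → b * (x * ℚ.1/ b) ≡ x
    *-cancel-1/ b x = begin
      b * (x * ℚ.1/ b)   ≡⟨ ℚ.*-comm b _ ⟩
      x * ℚ.1/ b * b     ≡⟨ ℚ.*-assoc x (ℚ.1/ b) b ⟩
      x * (ℚ.1/ b * b)   ≡⟨ cong (x *_) (ℚ.*-inverseˡ b) ⟩
      x * 1ℚ             ≡⟨ ℚ.*-identityʳ x ⟩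
      x                  ∎
      where open ≡-Reasoning

    -+-cancel : ∀ x y → (x - y) + y ≡ x
    -+-cancel x y = begin
      (x - y) + y      ≡⟨ ℚ.+-assoc x (- y) y ⟩
      x + (- y + y)    ≡⟨ cong (x +_) (ℚ.+-inverseˡ y) ⟩
      x + 0ℚ           ≡⟨ ℚ.+-identityʳ x ⟩
      x                ∎
      where open ≡-Reasoning

  divS-spec : ∀ a b .{{_ : ℚ.NonZero (b 0)}} → b ⊗ divS a b ≗ a
  divS-spec a b zero    = *-cancel-1/ (b 0) (a 0)
  divS-spec a b (suc n) = begin
    (b ⊗ q) (suc n)                               ≡⟨ ⊗-split-first b q n ⟩
    b 0 * q (suc n) + (tail b ⊗ q) n              ≡⟨ cong (b 0 * q (suc n) +_) earlier-terms ⟩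
    b 0 * ((a (suc n) - Σ) * ℚ.1/ b 0) + Σ        ≡⟨ cong (_+ Σ) (*-cancel-1/ (b 0) (a (suc n) - Σ)) ⟩
    (a (suc n) - Σ) + Σ                           ≡⟨ -+-cancel (a (suc n)) Σ ⟩
    a (suc n)                                     ∎
    where
    open ≡-Reasoning
    q = divS a b
    Σ = sumFrom1 (suc n) (λ i → b i * at (divL a b n) (i ∸ 1))
    earlier-terms : (tail b ⊗ q) n ≡ Σ
    earlier-terms = trans (sumTo-suc n (λ i → b i * q (n ∸ (i ∸ 1))))
      (sumFrom1-cong (suc n) λ { (suc i) _ (s≤s i≤n) → cong (b (suc i) *_) (sym (divL-at a b n i i≤n)) })

  at-++ˡ : ∀ xs ys i → i ℕ.< length xs → at (xs ++ ys) i ≡ at xs i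
  at-++ˡ (x ∷ xs) ys zero    _         = refl
  at-++ˡ (x ∷ xs) ys (suc i) (s≤s i<n) = at-++ˡ xs ys i i<n

  at-++-length : ∀ xs y → at (xs ++ [ y ]) (length xs) ≡ y
  at-++-length []       y = refl
  at-++-length (x ∷ xs) y = at-++-length xs y

  length-sqrtL : ∀ c n → length (sqrtL c n) ≡ suc n
  length-sqrtL c zero    = refl
  length-sqrtL c (suc n) =
    trans (length-++ (sqrtL c n)) (trans (cong (ℕ._+ 1) (length-sqrtL c n)) (ℕ.+-comm (suc n) 1))

  sqrtL-at : ∀ c n i → i ≤ n → at (sqrtL c n) i ≡ sqrtS c i
  sqrtL-at c zero    zero    _   = refl
  sqrtL-at c (suc n) i       i≤1+n with ℕ.m≤n⇒m<n∨m≡n i≤1+n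
  ... | inj₁ (s≤s i≤n) =
    trans (at-++ˡ (sqrtL c n) _ i (subst (i ℕ.<_) (sym (length-sqrtL c n)) (s≤s i≤n))) (sqrtL-at c n i i≤n)
  ... | inj₂ refl      = refl

  sqrtS-suc : ∀ c n → sqrtS c (suc n) ≡ (c (suc n) - sumFrom1 n (λ i → sqrtS c i * sqrtS c (suc n ∸ i))) * ½
  sqrtS-suc c n =
    trans (subst (λ k → at (sqrtL c n ++ [ v ]) k ≡ v) (length-sqrtL c n) (at-++-length (sqrtL c n) v))
    (cong (λ Σ → (c (suc n) - Σ) * ½) (sumFrom1-cong n λ { (suc i) _ i≤n →
      cong₂ _*_ (sqrtL-at c n (suc i) i≤n) (sqrtL-at c n (n ∸ i) (ℕ.m∸n≤m n i)) }))
    where v = (c (suc n) - sumFrom1 n (λ i → at (sqrtL c n) i * at (sqrtL c n) (suc n ∸ i))) * ½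

  sqrtS-spec : ∀ c → c 0 ≡ 1ℚ → sqrtS c ⊗ sqrtS c ≗ c
  sqrtS-spec c c0≡1 zero    = sym c0≡1
  sqrtS-spec c c0≡1 (suc n) = begin
    (s ⊗ s) (suc n)                                    ≡⟨ ⊗-split-last s s n ⟩
    (s ⊗ tail s) n + s (suc n) * 1ℚ                    ≡⟨ cong (_+ s (suc n) * 1ℚ) (sumTo-sumFrom1 n _) ⟩
    1ℚ * s (suc n) + Σ′ + s (suc n) * 1ℚ               ≡⟨ cong (λ x → 1ℚ * s (suc n) + x + s (suc n) * 1ℚ) Σ′≡Σ ⟩
    1ℚ * s (suc n) + Σ + s (suc n) * 1ℚ                ≡⟨ cong (λ x → 1ℚ * x + Σ + x * 1ℚ) (sqrtS-suc c n) ⟩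
    1ℚ * ((C - Σ) * ½) + Σ + (C - Σ) * ½ * 1ℚ          ≡⟨ halves C Σ ⟩
    C                                                  ∎
    where
    open ≡-Reasoning
    s = sqrtS c
    C = c (suc n)
    Σ′ = sumFrom1 n (λ i → s i * s (suc (n ∸ i)))
    Σ = sumFrom1 n (λ i → s i * s (suc n ∸ i))
    Σ′≡Σ : Σ′ ≡ Σ
    Σ′≡Σ = sumFrom1-cong n (λ i _ i≤n → cong (λ k → s i * s k) (sym (ℕ.+-∸-assoc 1 i≤n)))
    halves : ∀ C Σ → 1ℚ * ((C - Σ) * ½) + Σ + (C - Σ) * ½ * 1ℚ ≡ C
    halves = solve 2 (λ C Σ → con 1ℚ :* ((C :- Σ) :* con ½) :+ Σ :+ (C :- Σ) :* con ½ :* con 1ℚ := C) refl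
      where open ℚ-Solver

  tail-⊗ : ∀ f g → f 0 ≡ 0ℚ → tail (f ⊗ g) ≗ tail f ⊗ g
  tail-⊗ f g f0≡0 n = begin
    (f ⊗ g) (suc n)                    ≡⟨ ⊗-split-first f g n ⟩
    f 0 * g (suc n) + (tail f ⊗ g) n   ≡⟨ cong (λ x → x * g (suc n) + (tail f ⊗ g) n) f0≡0 ⟩
    0ℚ * g (suc n) + (tail f ⊗ g) n    ≡⟨ cong (_+ (tail f ⊗ g) n) (ℚ.*-zeroˡ (g (suc n))) ⟩
    0ℚ + (tail f ⊗ g) n                ≡⟨ ℚ.+-identityˡ _ ⟩
    (tail f ⊗ g) n                     ∎
    where open ≡-Reasoning

  tail-const-⊗ : ∀ c g → tail (const c ⊗ g) ≗ const c ⊗ tail g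
  tail-const-⊗ c g n = trans (const-⊗ c g (suc n)) (sym (const-⊗ c (tail g) n))

open PowerSeries

module FPS = CommutativeRing FPS-commutativeRing
open Sums FPS.commutativeSemiring
module ℚ-Sums = Sums (CommutativeRing.commutativeSemiring ℚ.+-*-commutativeRing)
open ℚ-Sums using () renaming (∑ to ∑ℚ)

∑-at : ∀ {A : Set} (xs : List A) (g : A → FPS) n → ∑ xs g n ≡ ∑ℚ xs (λ x → g x n)
∑-at []       g n = 0S≡0 n
∑-at (x ∷ xs) g n = ≡.cong (g x n ℚ.+_) (∑-at xs g n)

tail-∑ : ∀ {A : Set} (xs : List A) (g : A → FPS) → tail (∑ xs g) ≗ ∑ xs (tail ∘ g)
tail-∑ []       g n = ≡.sym (0S≡0 n)
tail-∑ (x ∷ xs) g n = ≡.cong (g x (suc n) ℚ.+_) (tail-∑ xs g n)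

module Paths where

  open import Data.Bool.Properties using (∧-zeroʳ; ∧-identityʳ; ∧-assoc)
  open import Data.List using (length; filter; concatMap)
  open import Data.Nat.Coprimality as Coprime using (1-coprimeTo)
  import Data.Integer.Properties as ℤ using (*-identityʳ)
  open import Data.Rational using (ℚ; 0ℚ; 1ℚ; _+_; _*_; _/_)
  open import Data.Rational.Solver using () renaming (module +-*-Solver to ℚ-Solver)
  open import Relation.Binary.Definitions using (DecidableEquality)
  import Relation.Binary.Reasoning.Setoid as SetoidReasoning
  open import Relation.Nullary.Decidable using (T?)
  open ≡ using (refl; sym; trans; cong; cong₂; module ≡-Reasoning)

  fromℕ : ℕ → ℚ
  fromℕ n = ℤ.+ n / 1

  fromℕ-+ : ∀ m n → fromℕ (m ℕ.+ n) ≡ fromℕ m + fromℕ n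
  fromℕ-+ m n
    rewrite ℚ.normalize-coprime {m} {0} (Coprime.sym (1-coprimeTo m))
          | ℚ.normalize-coprime {n} {0} (Coprime.sym (1-coprimeTo n))
          = cong (_/ 1) (sym (cong₂ ℤ._+_ (ℤ.*-identityʳ (ℤ.+ m)) (ℤ.*-identityʳ (ℤ.+ n))))

  ind : Bool → ℚ
  ind true  = 1ℚ
  ind false = 0ℚ

  gf : (List Step → Bool) → FPS
  gf P n = ∑ℚ (words n) (ind ∘ P)

  fromℕ-length-filter : ∀ (P : List Step → Bool) ws →
                        fromℕ (length (filter (λ w → T? (P w)) ws)) ≡ ∑ℚ ws (ind ∘ P)
  fromℕ-length-filter P []       = refl
  fromℕ-length-filter P (w ∷ ws) with P w
  ... | true  = trans (fromℕ-+ 1 (length (filter (λ w → T? (P w)) ws)))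
                      (cong (1ℚ +_) (fromℕ-length-filter P ws))
  ... | false = trans (fromℕ-length-filter P ws) (sym (ℚ.+-identityˡ (∑ℚ ws (ind ∘ P))))

  countS≗gf : countS ≗ gf admissible
  countS≗gf n = fromℕ-length-filter admissible (words n)

  steps : List Step
  steps = U ∷ D ∷ R ∷ []

  ∑-words-suc : ∀ ws (g : List Step → ℚ) →
    ∑ℚ (concatMap (λ w → (U ∷ w) ∷ (D ∷ w) ∷ (R ∷ w) ∷ []) ws) g ≡ ∑ℚ steps (λ l → ∑ℚ ws (g ∘ (l ∷_)))
  ∑-words-suc []       g = refl
  ∑-words-suc (w ∷ ws) g =
    trans (cong (λ s → g (U ∷ w) + (g (D ∷ w) + (g (R ∷ w) + s))) (∑-words-suc ws g))
          (regroup (g (U ∷ w)) (g (D ∷ w)) (g (R ∷ w)) _ _ _)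
    where
    open ℚ-Solver
    regroup : ∀ a b c x y z → a + (b + (c + (x + (y + (z + 0ℚ))))) ≡ (a + x) + ((b + y) + ((c + z) + 0ℚ))
    regroup = solve 6 (λ a b c x y z → a :+ (b :+ (c :+ (x :+ (y :+ (z :+ con 0ℚ)))))
                                     := (a :+ x) :+ ((b :+ y) :+ ((c :+ z) :+ con 0ℚ))) refl

  gf-zero : ∀ P → gf P 0 ≡ ind (P [])
  gf-zero P = ℚ.+-identityʳ (ind (P []))

  gf-suc : ∀ P → tail (gf P) ≗ ∑ steps (λ l → gf (P ∘ (l ∷_)))
  gf-suc P n = trans (∑-words-suc (words n) (ind ∘ P)) (sym (∑-at steps (λ l → gf (P ∘ (l ∷_))) n))

  gf-cong : ∀ {P Q : List Step → Bool} → (∀ w → P w ≡ Q w) → gf P ≗ gf Q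
  gf-cong P≡Q n = ℚ-Sums.∑-cong (words n) (cong ind ∘ P≡Q)

  gf-none : gf (λ _ → false) ≗ 0S
  gf-none n = trans (ℚ-Sums.∑-zero (words n)) (sym (0S≡0 n))

  gf-only-empty : ∀ b → gf (λ w → null w ∧ b) ≗ const (ind b)
  gf-only-empty b zero    = gf-zero (λ w → null w ∧ b)
  gf-only-empty b (suc n) =
    trans (gf-suc (λ w → null w ∧ b) n) (trans (∑-cong steps (λ _ → gf-none) n) (trans (∑-zero steps n) (0S≡0 n)))

  -- An automaton for the local conditions

  data Colour : Set where
    black red : Colour

  -- After a down step, the state records its colour and whether the
  -- current maximal down-run has even length.
  data State : Set where
    up   : State
    down : Colour → Bool → State

  evenRun : State → Bool
  evenRun up         = true
  evenRun (down _ e) = e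

  move : State → Step → Maybe State
  move s              D = just (down black (not (evenRun s)))
  move up             R = nothing
  move (down _ e)     R = just (down red (not e))
  move up             U = just up
  move (down black _) U = just up
  move (down red _)   U = nothing

  -- the height after a step taken at height suc h
  heightAfter : Step → ℕ → ℕ
  heightAfter U h = suc (suc h)
  heightAfter D h = h
  heightAfter R h = h

  settled : State → Bool
  settled up         = true
  settled (down _ e) = not e

  accept : ℕ → State → List Step → Bool
  accept zero    s []      = settled s
  accept zero    s (U ∷ w) = settled s ∧ maybe′ (λ s′ → accept 1 s′ w) false (move s U)
  accept zero    s (D ∷ w) = false
  accept zero    s (R ∷ w) = false
  accept (suc h) s []      = true
  accept (suc h) s (l ∷ w) = maybe′ (λ s′ → accept (heightAfter l h) s′ w) false (move s l)

  isEven-suc : ∀ n → isEven (suc n) ≡ not (isEven n)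
  isEven-suc zero          = refl
  isEven-suc (suc zero)    = refl
  isEven-suc (suc (suc n)) = isEven-suc n

  downStep : Colour → Step
  downStep black = D
  downStep red   = R

  longer-run : ∀ h r c w → accept h (down c (isEven (suc (suc r)))) w ≡ accept h (down c (not (isEven (suc r)))) w
  longer-run h r c w = cong (λ e → accept h (down c e) w) (isEven-suc (suc r))

  walk-after-up : ∀ h w → walk h 0 w ∧ noForbidden (U ∷ w) ≡ accept h up w
  walk-after-down : ∀ h r c w →
    walk h (suc r) w ∧ noForbidden (downStep c ∷ w) ≡ accept h (down c (isEven (suc r))) w

  walk-after-up zero    []      = refl
  walk-after-up (suc h) []      = refl
  walk-after-up zero    (U ∷ w) = walk-after-up 1 w
  walk-after-up (suc h) (U ∷ w) = walk-after-up (suc (suc h)) w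
  walk-after-up zero    (D ∷ w) = refl
  walk-after-up (suc h) (D ∷ w) = walk-after-down h 0 black w
  walk-after-up zero    (R ∷ w) = refl
  walk-after-up (suc h) (R ∷ w) = ∧-zeroʳ (walk h 1 w)

  walk-after-down zero    r black []      = ∧-identityʳ _
  walk-after-down zero    r red   []      = ∧-identityʳ _
  walk-after-down (suc h) r black []      = refl
  walk-after-down (suc h) r red   []      = refl
  walk-after-down zero    r black (U ∷ w) =
    trans (∧-assoc (not (isEven (suc r))) _ _) (cong (not (isEven (suc r)) ∧_) (walk-after-up 1 w))
  walk-after-down (suc h) r black (U ∷ w) = walk-after-up (suc (suc h)) w
  walk-after-down zero    r red   (U ∷ w) = trans (∧-zeroʳ _) (sym (∧-zeroʳ _))
  walk-after-down (suc h) r red   (U ∷ w) = ∧-zeroʳ _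
  walk-after-down zero    r c     (D ∷ w) = refl
  walk-after-down (suc h) r black (D ∷ w) = trans (walk-after-down h (suc r) black w) (longer-run h r black w)
  walk-after-down (suc h) r red   (D ∷ w) = trans (walk-after-down h (suc r) black w) (longer-run h r black w)
  walk-after-down zero    r c     (R ∷ w) = refl
  walk-after-down (suc h) r black (R ∷ w) = trans (walk-after-down h (suc r) red w) (longer-run h r red w)
  walk-after-down (suc h) r red   (R ∷ w) = trans (walk-after-down h (suc r) red w) (longer-run h r red w)

  admissible≡accept : ∀ w → admissible w ≡ accept 0 up w
  admissible≡accept []      = refl
  admissible≡accept (U ∷ w) = walk-after-up 1 w
  admissible≡accept (D ∷ w) = refl
  admissible≡accept (R ∷ w) = refl

  -- First passages to the ground

  -- descend f e k s w reads w from height k in state s; on first reaching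
  -- height 0 it hands the rest of the word to f, and it returns e if the
  -- word ends above the ground.
  descend : (State → List Step → Bool) → Bool → ℕ → State → List Step → Bool
  descend f e zero    s w       = f s w
  descend f e (suc k) s []      = e
  descend f e (suc k) s (l ∷ w) = maybe′ (λ s′ → descend f e (heightAfter l k) s′ w) false (move s l)

  maybe′-cong : ∀ {A B : Set} {f g : A → B} b → (∀ x → f x ≡ g x) → ∀ mx → maybe′ f b mx ≡ maybe′ g b mx
  maybe′-cong b f≡g (just x) = f≡g x
  maybe′-cong b f≡g nothing  = refl

  maybe′-false : ∀ {A : Set} {g : A → Bool} → (∀ x → g x ≡ false) → ∀ mx → maybe′ g false mx ≡ false
  maybe′-false g≡false (just x) = g≡false x
  maybe′-false g≡false nothing  = refl

  accept≡descend : ∀ k s w → accept k s w ≡ descend (accept 0) true k s w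
  accept≡descend zero    s w       = refl
  accept≡descend (suc k) s []      = refl
  accept≡descend (suc k) s (l ∷ w) =
    maybe′-cong false (λ s′ → accept≡descend (heightAfter l k) s′ w) (move s l)

  descend-+ : ∀ f e j m s w → descend f e (j ℕ.+ m) s w ≡ descend (descend f e m) e j s w
  descend-+ f e zero    m s w       = refl
  descend-+ f e (suc j) m s []      = refl
  descend-+ f e (suc j) m s (U ∷ w) = maybe′-cong false (λ s′ → descend-+ f e (suc (suc j)) m s′ w) (move s U)
  descend-+ f e (suc j) m s (D ∷ w) = maybe′-cong false (λ s′ → descend-+ f e j m s′ w) (move s D)
  descend-+ f e (suc j) m s (R ∷ w) = maybe′-cong false (λ s′ → descend-+ f e j m s′ w) (move s R)

  _≟ᶜ_ : DecidableEquality Colour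
  black ≟ᶜ black = yes refl
  black ≟ᶜ red   = no λ ()
  red   ≟ᶜ black = no λ ()
  red   ≟ᶜ red   = yes refl

  _≟ˢ_ : DecidableEquality State
  up       ≟ˢ up         = yes refl
  up       ≟ˢ down _ _   = no λ ()
  down _ _ ≟ˢ up         = no λ ()
  down c e ≟ˢ down c′ e′ with c ≟ᶜ c′ | e Bool.≟ e′
  ... | yes refl | yes refl = yes refl
  ... | no c≢c′  | _        = no λ { refl → c≢c′ refl }
  ... | _        | no e≢e′  = no λ { refl → e≢e′ refl }

  δ : State → State → FPS
  δ s t = const (ind (does (s ≟ˢ t)))

  states : List State
  states = up ∷ down black true ∷ down black false ∷ down red true ∷ down red false ∷ []

  stopAt : State → State → List Step → Bool
  stopAt t s w = null w ∧ does (s ≟ˢ t)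

  firstPassage : ℕ → State → State → FPS
  firstPassage k s t = gf (descend (stopAt t) false k s)

  staysAbove : ℕ → State → FPS
  staysAbove k s = gf (descend (λ _ _ → false) true k s)

  -- a first passage to the ground ends with a down step
  descend-never-up : ∀ k s w → descend (stopAt up) false (suc k) s w ≡ false
  descend-never-up k       s          []      = refl
  descend-never-up k       s          (U ∷ w) = maybe′-false (λ s′ → descend-never-up (suc k) s′ w) (move s U)
  descend-never-up zero    s          (D ∷ w) = ∧-zeroʳ (null w)
  descend-never-up (suc k) s          (D ∷ w) = descend-never-up k (down black (not (evenRun s))) w
  descend-never-up zero    up         (R ∷ w) = refl
  descend-never-up zero    (down _ _) (R ∷ w) = ∧-zeroʳ (null w)
  descend-never-up (suc k) s          (R ∷ w) = maybe′-false (λ s′ → descend-never-up k s′ w) (move s R)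

  along : (ℕ → State → FPS) → ℕ → State → Step → FPS
  along X k s l = maybe′ (X (heightAfter l k)) 0S (move s l)

  next : (ℕ → State → FPS) → ℕ → State → FPS
  next X k s = ∑ steps (along X k s)

  record SolvesFirstStep (c : ℚ) (F : State → FPS) (X : ℕ → State → FPS) : Set where
    field
      ground : ∀ s → X 0 s ≗ F s
      empty  : ∀ k s → X (suc k) s 0 ≡ c
      step   : ∀ k s → tail (X (suc k) s) ≗ next X k s

  module _ {c F X Y} (x : SolvesFirstStep c F X) (y : SolvesFirstStep c F Y) where
    private
      module x = SolvesFirstStep x
      module y = SolvesFirstStep y

    first-step-unique : ∀ n k s → X k s n ≡ Y k s n
    first-step-unique n       zero    s = trans (x.ground s n) (sym (y.ground s n))
    first-step-unique zero    (suc k) s = trans (x.empty k s) (sym (y.empty k s))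
    first-step-unique (suc n) (suc k) s = begin
      X (suc k) s (suc n)                ≡⟨ x.step k s n ⟩
      next X k s n                       ≡⟨ ∑-at steps (along X k s) n ⟩
      ∑ℚ steps (λ l → along X k s l n)   ≡⟨ ℚ-Sums.∑-cong steps (λ l → along-cong l (move s l)) ⟩
      ∑ℚ steps (λ l → along Y k s l n)   ≡⟨ ∑-at steps (along Y k s) n ⟨
      next Y k s n                       ≡⟨ y.step k s n ⟨
      Y (suc k) s (suc n)                ∎
      where
      open ≡-Reasoning
      along-cong : ∀ l ms → maybe′ (X (heightAfter l k)) 0S ms n ≡ maybe′ (Y (heightAfter l k)) 0S ms n
      along-cong l (just s′) = first-step-unique n (heightAfter l k) s′
      along-cong l nothing   = refl

  gf-maybe : ∀ (P : State → List Step → Bool) ms →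
             gf (λ w → maybe′ (λ s′ → P s′ w) false ms) ≗ maybe′ (gf ∘ P) 0S ms
  gf-maybe P (just s′) n = refl
  gf-maybe P nothing     = gf-none

  descend-solves : ∀ f e → SolvesFirstStep (ind e) (gf ∘ f) (λ k s → gf (descend f e k s))
  descend-solves f e = record
    { ground = λ s n → refl
    ; empty  = λ k s → gf-zero (descend f e (suc k) s)
    ; step   = λ k s → FPS.trans (gf-suc (descend f e (suc k) s))
                 (∑-cong steps (λ l → gf-maybe (λ s′ → descend f e (heightAfter l k) s′) (move s l)))
    }

  ∑-δ : ∀ s → ∑ states (δ s) ≗ 1S
  ∑-δ up                 zero    = refl
  ∑-δ (down black true)  zero    = refl
  ∑-δ (down black false) zero    = refl
  ∑-δ (down red true)    zero    = refl
  ∑-δ (down red false)   zero    = refl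
  ∑-δ s                  (suc n) = refl

  ∑-select : ∀ s (F : State → FPS) → ∑ states (λ t → δ s t ⊗ F t) ≗ F s
  ∑-select s F = begin
    ∑ states (λ t → δ s t ⊗ F t)  ≈⟨ ∑-cong states only-s ⟩
    ∑ states (λ t → δ s t ⊗ F s)  ≈⟨ ∑-*ʳ states (F s) (δ s) ⟨
    ∑ states (δ s) ⊗ F s          ≈⟨ ⊗-congʳ (F s) (∑-δ s) ⟩
    1S ⊗ F s                      ≈⟨ ⊗-identityˡ (F s) ⟩
    F s                           ∎
    where
    open SetoidReasoning FPS.setoid
    only-s : ∀ t → δ s t ⊗ F t ≗ δ s t ⊗ F s
    only-s t with s ≟ˢ t
    ... | yes refl = FPS.refl
    ... | no  _    = FPS.trans (⊗-zeroˡ (F t)) (FPS.sym (⊗-zeroˡ (F s)))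

  along-linear : ∀ (A : State → ℕ → State → FPS) (F : State → FPS) C (B : ℕ → State → FPS) k s l →
    along (λ k s → ∑ states (λ t → A t k s ⊗ F t) ⊕ C ⊗ B k s) k s l
    ≗ ∑ states (λ t → along (A t) k s l ⊗ F t) ⊕ C ⊗ along B k s l
  along-linear A F C B k s l with move s l
  ... | just _  = FPS.refl
  ... | nothing = FPS.sym (FPS.trans (FPS.+-cong (FPS.trans (∑-cong states (λ t → FPS.zeroˡ (F t))) (∑-zero states))
                                                 (FPS.zeroʳ C))
                                     (FPS.+-identityʳ 0S))

  next-linear : ∀ (A : State → ℕ → State → FPS) (F : State → FPS) C (B : ℕ → State → FPS) k s →
    next (λ k s → ∑ states (λ t → A t k s ⊗ F t) ⊕ C ⊗ B k s) k s
    ≗ ∑ states (λ t → next (A t) k s ⊗ F t) ⊕ C ⊗ next B k s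
  next-linear A F C B k s = begin
    ∑ steps (λ l → along (λ k s → ∑ states (λ t → A t k s ⊗ F t) ⊕ C ⊗ B k s) k s l)
      ≈⟨ ∑-cong steps (along-linear A F C B k s) ⟩
    ∑ steps (λ l → ∑ states (λ t → along (A t) k s l ⊗ F t) ⊕ C ⊗ along B k s l)
      ≈⟨ ∑-+ steps (λ l → ∑ states (λ t → along (A t) k s l ⊗ F t)) (λ l → C ⊗ along B k s l) ⟩
    ∑ steps (λ l → ∑ states (λ t → along (A t) k s l ⊗ F t)) ⊕ ∑ steps (λ l → C ⊗ along B k s l)
      ≈⟨ FPS.+-cong (∑-comm steps states (λ l t → along (A t) k s l ⊗ F t))
                    (FPS.sym (∑-*ˡ steps C (along B k s))) ⟩
    ∑ states (λ t → ∑ steps (λ l → along (A t) k s l ⊗ F t)) ⊕ C ⊗ next B k s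
      ≈⟨ FPS.+-congʳ (∑-cong states (λ t → FPS.sym (∑-*ʳ steps (F t) (along (A t) k s)))) ⟩
    ∑ states (λ t → next (A t) k s ⊗ F t) ⊕ C ⊗ next B k s
      ∎
    where open SetoidReasoning FPS.setoid

  decomposition : (State → FPS) → Bool → ℕ → State → FPS
  decomposition F e k s = ∑ states (λ t → firstPassage k s t ⊗ F t) ⊕ const (ind e) ⊗ staysAbove k s

  decomposition-solves : ∀ F e → SolvesFirstStep (ind e) F (decomposition F e)
  decomposition-solves F e = record { ground = ground ; empty = empty ; step = step }
    where
    open SetoidReasoning FPS.setoid
    module FP t = SolvesFirstStep (descend-solves (stopAt t) false)
    module SA = SolvesFirstStep (descend-solves (λ _ _ → false) true)

    ground : ∀ s → decomposition F e 0 s ≗ F s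
    ground s = begin
      ∑ states (λ t → firstPassage 0 s t ⊗ F t) ⊕ const (ind e) ⊗ staysAbove 0 s
        ≈⟨ FPS.+-cong (∑-cong states (λ t → ⊗-congʳ (F t) (gf-only-empty (does (s ≟ˢ t)))))
                      (⊗-congˡ (const (ind e)) gf-none) ⟩
      ∑ states (λ t → δ s t ⊗ F t) ⊕ const (ind e) ⊗ 0S
        ≈⟨ FPS.+-cong (∑-select s F) (FPS.zeroʳ (const (ind e))) ⟩
      F s ⊕ 0S
        ≈⟨ FPS.+-identityʳ (F s) ⟩
      F s ∎

    empty : ∀ k s → decomposition F e (suc k) s 0 ≡ ind e
    empty k s = trans
      (cong₂ _+_ (ℚ-Sums.∑-cong states (λ t → trans (cong (_* F t 0) (FP.empty t k s)) (ℚ.*-zeroˡ (F t 0))))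
                 (cong (ind e *_) (SA.empty k s)))
      (trans (cong₂ _+_ (ℚ-Sums.∑-zero states) (ℚ.*-identityʳ (ind e))) (ℚ.+-identityˡ (ind e)))

    step : ∀ k s → tail (decomposition F e (suc k) s) ≗ next (decomposition F e) k s
    step k s = begin
      tail (decomposition F e (suc k) s)
        ≈⟨ FPS.+-cong (tail-∑ states (λ t → firstPassage (suc k) s t ⊗ F t)) FPS.refl ⟩
      ∑ states (λ t → tail (firstPassage (suc k) s t ⊗ F t)) ⊕ tail (const (ind e) ⊗ staysAbove (suc k) s)
        ≈⟨ FPS.+-cong (∑-cong states (λ t → tail-⊗ (firstPassage (suc k) s t) (F t) (FP.empty t k s)))
                      (tail-const-⊗ (ind e) (staysAbove (suc k) s)) ⟩
      ∑ states (λ t → tail (firstPassage (suc k) s t) ⊗ F t) ⊕ const (ind e) ⊗ tail (staysAbove (suc k) s)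
        ≈⟨ FPS.+-cong (∑-cong states (λ t → ⊗-congʳ (F t) (FP.step t k s)))
                      (⊗-congˡ (const (ind e)) (SA.step k s)) ⟩
      ∑ states (λ t → next (λ k s → firstPassage k s t) k s ⊗ F t) ⊕ const (ind e) ⊗ next staysAbove k s
        ≈⟨ next-linear (λ t k s → firstPassage k s t) F (const (ind e)) staysAbove k s ⟨
      next (decomposition F e) k s ∎

  gf-descend : ∀ f e k s →
    gf (descend f e k s) ≗ ∑ states (λ t → firstPassage k s t ⊗ gf (f t)) ⊕ const (ind e) ⊗ staysAbove k s
  gf-descend f e k s n = first-step-unique (descend-solves f e) (decomposition-solves (gf ∘ f) e) n k s

open Paths

open FPS
open FPS-Solver using (solve; _:=_; con; _:+_; _:*_; _:-_; :-_)
open import Relation.Binary.Reasoning.Setoid setoid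
open import Algebra.Properties.Group +-group using (x∙y⁻¹≈ε⇒x≈y; x≈y⇒x∙y⁻¹≈ε)
open import Data.Rational using (1ℚ; _/_)
open import Data.Integer using (+_; -[1+_])

κ : ℕ → FPS
κ n = const (fromℕ n)

⟨_⟩ : ∀ {n} → ℕ → FPS-Solver.Polynomial n
⟨ k ⟩ = con (fromℕ k)

vanish : ∀ k {p q} → p ≈ q → k * (p - q) ≈ 0#
vanish k p≈q = trans (*-congˡ {k} (x≈y⇒x∙y⁻¹≈ε p≈q)) (zeroʳ k)

infixl 5 _⊞_
_⊞_ : ∀ {x y} → x ≈ 0# → y ≈ 0# → x + y ≈ 0#
x≈0 ⊞ y≈0 = trans (+-cong x≈0 y≈0) (+-identityʳ 0#)

-- The identity lhs - rhs ≈ t is checked by the ring solver, with t an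
-- explicit combination Σ kᵢ (pᵢ - qᵢ) of hypotheses pᵢ ≈ qᵢ (built by
-- vanish and ⊞).
combine : ∀ {lhs rhs t} → lhs - rhs ≈ t → t ≈ 0# → lhs ≈ rhs
combine {lhs} {rhs} identity t≈0 = x∙y⁻¹≈ε⇒x≈y lhs rhs (trans identity t≈0)

*-cancelˡ : ∀ u {q} .{{_ : ℚ.NonZero q}} → u 0 ≡ q → ∀ {x y} → u * x ≈ u * y → x ≈ y
*-cancelˡ u u0≡q {x} {y} ux≈uy = x∙y⁻¹≈ε⇒x≈y x y (⊗-zero-cancelˡ u u0≡q (x - y) (combine
  (solve 3 (λ u x y → u :* (x :- y) :- ⟨ 0 ⟩ := ⟨ 1 ⟩ :* (u :* x :- u :* y)) (λ _ → ≡.refl) u x y)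
  (vanish 1# ux≈uy)))

1-z*-at-0 : ∀ g → (1# - z * g) 0 ≡ 1ℚ
1-z*-at-0 g = ≡.cong (λ w → 1ℚ ℚ.+ ℚ.- w) (z⊗-zero g)

square-root-unique : ∀ {s t q} .{{_ : ℚ.NonZero q}} → (s + t) 0 ≡ q → s * s ≈ t * t → s ≈ t
square-root-unique {s} {t} s+t≡q ss≈tt = *-cancelˡ (s + t) s+t≡q (combine
  (solve 2 (λ s t → (s :+ t) :* s :- (s :+ t) :* t := ⟨ 1 ⟩ :* (s :* s :- t :* t)) (λ _ → ≡.refl) s t)
  (vanish 1# ss≈tt))

-- The functional equations

first-step : ∀ f e k s →
  gf (descend f e (suc k) s) ≈ const (ind e) + z * next (λ k s → gf (descend f e k s)) k s
first-step f e k s = head-tail (empty k s) (step k s)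
  where open SolvesFirstStep (descend-solves f e)

firstPassage-ground : ∀ s t → firstPassage 0 s t ≈ δ s t
firstPassage-ground s t = gf-only-empty (does (s ≟ˢ t))

u v : State → FPS
u = firstPassage 1 up
v = firstPassage 2 up

reach : Bool → State → FPS
reach p t = δ (down black p) t + δ (down red p) t

oneStep : State → State → FPS
oneStep up             t = z * (v t + δ (down black false) t)
oneStep (down black e) t = z * (v t + reach (not e) t)
oneStep (down red e)   t = z * reach (not e) t

firstPassage-oneStep : ∀ s t → firstPassage 1 s t ≈ oneStep s t
firstPassage-oneStep up t = combine
  (solve 5 (λ z P V F D →
      P :- z :* (V :+ D)
      := ⟨ 1 ⟩ :* (P :- (⟨ 0 ⟩ :+ z :* (V :+ (F :+ (⟨ 0 ⟩ :+ ⟨ 0 ⟩))))) :+ z :* (F :- D))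
    (λ _ → ≡.refl) z (u t) (v t) (firstPassage 0 (down black false) t) (δ (down black false) t))
  (vanish 1# (first-step (stopAt t) false 0 up) ⊞ vanish z (firstPassage-ground (down black false) t))
firstPassage-oneStep (down black e) t = combine
  (solve 7 (λ z P V F₁ F₂ D₁ D₂ →
      P :- z :* (V :+ (D₁ :+ D₂))
      := ⟨ 1 ⟩ :* (P :- (⟨ 0 ⟩ :+ z :* (V :+ (F₁ :+ (F₂ :+ ⟨ 0 ⟩)))))
         :+ z :* (F₁ :- D₁) :+ z :* (F₂ :- D₂))
    (λ _ → ≡.refl) z (firstPassage 1 (down black e) t) (v t)
    (firstPassage 0 (down black (not e)) t) (firstPassage 0 (down red (not e)) t)
    (δ (down black (not e)) t) (δ (down red (not e)) t))
  (vanish 1# (first-step (stopAt t) false 0 (down black e))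
   ⊞ vanish z (firstPassage-ground (down black (not e)) t)
   ⊞ vanish z (firstPassage-ground (down red (not e)) t))
firstPassage-oneStep (down red e) t = combine
  (solve 6 (λ z P F₁ F₂ D₁ D₂ →
      P :- z :* (D₁ :+ D₂)
      := ⟨ 1 ⟩ :* (P :- (⟨ 0 ⟩ :+ z :* (⟨ 0 ⟩ :+ (F₁ :+ (F₂ :+ ⟨ 0 ⟩)))))
         :+ z :* (F₁ :- D₁) :+ z :* (F₂ :- D₂))
    (λ _ → ≡.refl) z (firstPassage 1 (down red e) t)
    (firstPassage 0 (down black (not e)) t) (firstPassage 0 (down red (not e)) t)
    (δ (down black (not e)) t) (δ (down red (not e)) t))
  (vanish 1# (first-step (stopAt t) false 0 (down red e))
   ⊞ vanish z (firstPassage-ground (down black (not e)) t)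
   ⊞ vanish z (firstPassage-ground (down red (not e)) t))

N M : FPS
N = staysAbove 1 up
M = staysAbove 2 up

oneStepAbove : State → FPS
oneStepAbove up             = 1# + z * M
oneStepAbove (down black _) = 1# + z * M
oneStepAbove (down red _)   = 1#

staysAbove-oneStep : ∀ s → staysAbove 1 s ≈ oneStepAbove s
staysAbove-oneStep up = combine
  (solve 4 (λ z N M S →
      N :- (⟨ 1 ⟩ :+ z :* M)
      := ⟨ 1 ⟩ :* (N :- (⟨ 1 ⟩ :+ z :* (M :+ (S :+ (⟨ 0 ⟩ :+ ⟨ 0 ⟩))))) :+ z :* (S :- ⟨ 0 ⟩))
    (λ _ → ≡.refl) z N M (staysAbove 0 (down black false)))
  (vanish 1# (first-step (λ _ _ → false) true 0 up) ⊞ vanish z gf-none)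
staysAbove-oneStep (down black e) = combine
  (solve 5 (λ z N M S₁ S₂ →
      N :- (⟨ 1 ⟩ :+ z :* M)
      := ⟨ 1 ⟩ :* (N :- (⟨ 1 ⟩ :+ z :* (M :+ (S₁ :+ (S₂ :+ ⟨ 0 ⟩)))))
         :+ z :* (S₁ :- ⟨ 0 ⟩) :+ z :* (S₂ :- ⟨ 0 ⟩))
    (λ _ → ≡.refl) z (staysAbove 1 (down black e)) M
    (staysAbove 0 (down black (not e))) (staysAbove 0 (down red (not e))))
  (vanish 1# (first-step (λ _ _ → false) true 0 (down black e)) ⊞ vanish z gf-none ⊞ vanish z gf-none)
staysAbove-oneStep (down red e) = combine
  (solve 4 (λ z N S₁ S₂ →
      N :- ⟨ 1 ⟩
      := ⟨ 1 ⟩ :* (N :- (⟨ 1 ⟩ :+ z :* (⟨ 0 ⟩ :+ (S₁ :+ (S₂ :+ ⟨ 0 ⟩)))))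
         :+ z :* (S₁ :- ⟨ 0 ⟩) :+ z :* (S₂ :- ⟨ 0 ⟩))
    (λ _ → ≡.refl) z (staysAbove 1 (down red e))
    (staysAbove 0 (down black (not e))) (staysAbove 0 (down red (not e))))
  (vanish 1# (first-step (λ _ _ → false) true 0 (down red e)) ⊞ vanish z gf-none ⊞ vanish z gf-none)

A B : FPS
A = gf (accept 0 up)
B = gf (accept 1 up)

atGround : State → FPS
atGround up                 = A
atGround (down _ true)      = 0#
atGround (down black false) = A
atGround (down red false)   = 1#

accept-atGround : ∀ t → gf (accept 0 t) ≈ atGround t
accept-atGround up                 = refl
accept-atGround (down black false) = gf-cong like-start
  where
  like-start : ∀ w → accept 0 (down black false) w ≡ accept 0 up w
  like-start []      = ≡.refl
  like-start (U ∷ w) = ≡.refl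
  like-start (D ∷ w) = ≡.refl
  like-start (R ∷ w) = ≡.refl
accept-atGround (down red false)   = trans (gf-cong only-empty) (gf-only-empty true)
  where
  only-empty : ∀ w → accept 0 (down red false) w ≡ (null w ∧ true)
  only-empty []      = ≡.refl
  only-empty (U ∷ w) = ≡.refl
  only-empty (D ∷ w) = ≡.refl
  only-empty (R ∷ w) = ≡.refl
accept-atGround (down c true)      = trans (gf-cong rejects) gf-none
  where
  rejects : ∀ w → accept 0 (down c true) w ≡ false
  rejects []      = ≡.refl
  rejects (U ∷ w) = ≡.refl
  rejects (D ∷ w) = ≡.refl
  rejects (R ∷ w) = ≡.refl

A-first-step : A ≈ 1# + z * B
A-first-step = combine
  (solve 4 (λ z A B G →
      A :- (⟨ 1 ⟩ :+ z :* B)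
      := ⟨ 1 ⟩ :* (A :- (⟨ 1 ⟩ :+ z :* (B :+ (G :+ (G :+ ⟨ 0 ⟩))))) :+ z :* (G :- ⟨ 0 ⟩) :+ z :* (G :- ⟨ 0 ⟩))
    (λ _ → ≡.refl) z A B (gf (λ _ → false)))
  (vanish 1# (head-tail {A} (gf-zero (accept 0 up)) (gf-suc (accept 0 up))) ⊞ vanish z gf-none ⊞ vanish z gf-none)

v-up : v up ≈ 0#
v-up = trans (gf-cong (descend-never-up 1 up)) gf-none

v-sum : ∀ t → v t ≈ ∑ states (λ m → oneStep up m * oneStep m t) + 0# * N
v-sum t = begin
  v t
    ≈⟨ gf-cong (descend-+ (stopAt t) false 1 1 up) ⟩
  gf (descend (descend (stopAt t) false 1) false 1 up)
    ≈⟨ gf-descend (descend (stopAt t) false 1) false 1 up ⟩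
  ∑ states (λ m → u m * firstPassage 1 m t) + 0# * N
    ≈⟨ +-congʳ {0# * N}
         (∑-cong states (λ m → *-cong (firstPassage-oneStep up m) (firstPassage-oneStep m t))) ⟩
  ∑ states (λ m → oneStep up m * oneStep m t) + 0# * N ∎

M-sum : M ≈ ∑ states (λ m → oneStep up m * oneStepAbove m) + 1# * N
M-sum = begin
  M
    ≈⟨ gf-cong (descend-+ (λ _ _ → false) true 1 1 up) ⟩
  gf (descend (descend (λ _ _ → false) true 1) true 1 up)
    ≈⟨ gf-descend (descend (λ _ _ → false) true 1) true 1 up ⟩
  ∑ states (λ m → u m * staysAbove 1 m) + 1# * N
    ≈⟨ +-congʳ {1# * N} (∑-cong states (λ m → *-cong (firstPassage-oneStep up m) (staysAbove-oneStep m))) ⟩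
  ∑ states (λ m → oneStep up m * oneStepAbove m) + 1# * N ∎

B-sum : B ≈ ∑ states (λ m → oneStep up m * atGround m) + 1# * N
B-sum = begin
  B
    ≈⟨ gf-cong (accept≡descend 1 up) ⟩
  gf (descend (accept 0) true 1 up)
    ≈⟨ gf-descend (accept 0) true 1 up ⟩
  ∑ states (λ m → u m * gf (accept 0 m)) + 1# * N
    ≈⟨ +-congʳ {1# * N} (∑-cong states (λ m → *-cong (firstPassage-oneStep up m) (accept-atGround m))) ⟩
  ∑ states (λ m → oneStep up m * atGround m) + 1# * N ∎

-- Elimination

a b c d X L : FPS
a = v (down black true)
b = v (down black false)
c = v (down red true)
d = v (down red false)
X = z * (a + b + 1#)
L = 1# - z * X

v-linear : ∀ t → L * v t ≈ z * z * ((a + c) * reach false t + (b + 1# + d) * reach true t)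
v-linear t = combine
  (solve 12 (λ z V N V↑ a b c d F₁ F₂ T₁ T₂ →
      (⟨ 1 ⟩ :- z :* (z :* (a :+ b :+ ⟨ 1 ⟩))) :* V
        :- z :* z :* ((a :+ c) :* (F₁ :+ F₂) :+ (b :+ ⟨ 1 ⟩ :+ d) :* (T₁ :+ T₂))
      := ⟨ 1 ⟩ :* (V :- (z :* (V↑ :+ ⟨ 0 ⟩) :* (z :* (V :+ F₁))
                        :+ (z :* (a :+ ⟨ 0 ⟩) :* (z :* (V :+ (F₁ :+ F₂)))
                        :+ (z :* (b :+ ⟨ 1 ⟩) :* (z :* (V :+ (T₁ :+ T₂)))
                        :+ (z :* (c :+ ⟨ 0 ⟩) :* (z :* (F₁ :+ F₂))
                        :+ (z :* (d :+ ⟨ 0 ⟩) :* (z :* (T₁ :+ T₂))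
                        :+ ⟨ 0 ⟩)))) :+ ⟨ 0 ⟩ :* N))
         :+ z :* z :* (V :+ F₁) :* (V↑ :- ⟨ 0 ⟩))
    (λ _ → ≡.refl) z (v t) N (v up) a b c d
    (δ (down black false) t) (δ (down red false) t) (δ (down black true) t) (δ (down red true) t))
  (vanish 1# (v-sum t) ⊞ vanish (z * z * (v t + δ (down black false) t)) v-up)

v-even : ∀ col → L * v (down col true) ≈ z * z * (b + 1# + d)
v-even black = combine
  (solve 7 (λ z L a b c d V →
      L :* V :- z :* z :* (b :+ ⟨ 1 ⟩ :+ d)
      := ⟨ 1 ⟩ :* (L :* V :- z :* z :* ((a :+ c) :* (⟨ 0 ⟩ :+ ⟨ 0 ⟩) :+ (b :+ ⟨ 1 ⟩ :+ d) :* (⟨ 1 ⟩ :+ ⟨ 0 ⟩))))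
    (λ _ → ≡.refl) z L a b c d a)
  (vanish 1# (v-linear (down black true)))
v-even red = combine
  (solve 7 (λ z L a b c d V →
      L :* V :- z :* z :* (b :+ ⟨ 1 ⟩ :+ d)
      := ⟨ 1 ⟩ :* (L :* V :- z :* z :* ((a :+ c) :* (⟨ 0 ⟩ :+ ⟨ 0 ⟩) :+ (b :+ ⟨ 1 ⟩ :+ d) :* (⟨ 0 ⟩ :+ ⟨ 1 ⟩))))
    (λ _ → ≡.refl) z L a b c d c)
  (vanish 1# (v-linear (down red true)))

v-odd : ∀ col → L * v (down col false) ≈ z * z * (a + c)
v-odd black = combine
  (solve 7 (λ z L a b c d V →
      L :* V :- z :* z :* (a :+ c)
      := ⟨ 1 ⟩ :* (L :* V :- z :* z :* ((a :+ c) :* (⟨ 1 ⟩ :+ ⟨ 0 ⟩) :+ (b :+ ⟨ 1 ⟩ :+ d) :* (⟨ 0 ⟩ :+ ⟨ 0 ⟩))))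
    (λ _ → ≡.refl) z L a b c d b)
  (vanish 1# (v-linear (down black false)))
v-odd red = combine
  (solve 7 (λ z L a b c d V →
      L :* V :- z :* z :* (a :+ c)
      := ⟨ 1 ⟩ :* (L :* V :- z :* z :* ((a :+ c) :* (⟨ 0 ⟩ :+ ⟨ 1 ⟩) :+ (b :+ ⟨ 1 ⟩ :+ d) :* (⟨ 0 ⟩ :+ ⟨ 0 ⟩))))
    (λ _ → ≡.refl) z L a b c d d)
  (vanish 1# (v-linear (down red false)))

-- a and c (and likewise b and d) solve the same linear equation, whose
-- coefficient L has constant term 1.
a≈c : a ≈ c
a≈c = *-cancelˡ L (1-z*-at-0 X) (trans (v-even black) (sym (v-even red)))

b≈d : b ≈ d
b≈d = *-cancelˡ L (1-z*-at-0 X) (trans (v-odd black) (sym (v-odd red)))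

X-quadratic : z * X * X + (z * z - 1#) * X + z - z * z * z ≈ 0#
X-quadratic = combine
  (solve 5 (λ z a b c d →
      z :* (z :* (a :+ b :+ ⟨ 1 ⟩)) :* (z :* (a :+ b :+ ⟨ 1 ⟩)) :+ (z :* z :- ⟨ 1 ⟩) :* (z :* (a :+ b :+ ⟨ 1 ⟩))
        :+ z :- z :* z :* z :- ⟨ 0 ⟩
      := (:- z) :* ((⟨ 1 ⟩ :- z :* (z :* (a :+ b :+ ⟨ 1 ⟩))) :* a :- z :* z :* (b :+ ⟨ 1 ⟩ :+ d))
         :+ (:- z) :* ((⟨ 1 ⟩ :- z :* (z :* (a :+ b :+ ⟨ 1 ⟩))) :* b :- z :* z :* (a :+ c))
         :+ (:- (z :* z :* z)) :* (c :- a) :+ (:- (z :* z :* z)) :* (d :- b))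
    (λ _ → ≡.refl) z a b c d)
  (vanish (- z) (v-even black) ⊞ vanish (- z) (v-odd black)
   ⊞ vanish (- (z * z * z)) (sym a≈c) ⊞ vanish (- (z * z * z)) (sym b≈d))

E : FPS
E = z * (b + 1#)

E-linear : (1# - z * (X - κ 2 * z)) * E ≈ z + z * z * X
E-linear = combine
  (solve 5 (λ z a b c d →
      (⟨ 1 ⟩ :- z :* (z :* (a :+ b :+ ⟨ 1 ⟩) :- ⟨ 2 ⟩ :* z)) :* (z :* (b :+ ⟨ 1 ⟩))
        :- (z :+ z :* z :* (z :* (a :+ b :+ ⟨ 1 ⟩)))
      := z :* ((⟨ 1 ⟩ :- z :* (z :* (a :+ b :+ ⟨ 1 ⟩))) :* b :- z :* z :* (a :+ c)) :+ z :* z :* z :* (c :- a))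
    (λ _ → ≡.refl) z a b c d)
  (vanish z (v-odd black) ⊞ vanish (z * z * z) (sym a≈c))

N-linear : (1# - z * (1# + X)) * N ≈ 1# + z * X - z * z
N-linear = combine
  (solve 8 (λ z a b c d N M V↑ →
      (⟨ 1 ⟩ :- z :* (⟨ 1 ⟩ :+ z :* (a :+ b :+ ⟨ 1 ⟩))) :* N
        :- (⟨ 1 ⟩ :+ z :* (z :* (a :+ b :+ ⟨ 1 ⟩)) :- z :* z)
      := (⟨ 1 ⟩ :- z :* (z :* (a :+ b :+ ⟨ 1 ⟩))) :* (N :- (⟨ 1 ⟩ :+ z :* M))
         :+ z :* (M :- (z :* (V↑ :+ ⟨ 0 ⟩) :* (⟨ 1 ⟩ :+ z :* M)
                       :+ (z :* (a :+ ⟨ 0 ⟩) :* (⟨ 1 ⟩ :+ z :* M)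
                       :+ (z :* (b :+ ⟨ 1 ⟩) :* (⟨ 1 ⟩ :+ z :* M)
                       :+ (z :* (c :+ ⟨ 0 ⟩) :* ⟨ 1 ⟩
                       :+ (z :* (d :+ ⟨ 0 ⟩) :* ⟨ 1 ⟩
                       :+ ⟨ 0 ⟩)))) :+ ⟨ 1 ⟩ :* N))
         :+ z :* z :* (⟨ 1 ⟩ :+ z :* M) :* (V↑ :- ⟨ 0 ⟩)
         :+ z :* z :* (c :- a) :+ z :* z :* (d :- b))
    (λ _ → ≡.refl) z a b c d N M (v up))
  (vanish L (staysAbove-oneStep up) ⊞ vanish z M-sum ⊞ vanish (z * z * (1# + z * M)) v-up
   ⊞ vanish (z * z) (sym a≈c) ⊞ vanish (z * z) (sym b≈d))

A-linear : (1# - z * E) * A ≈ 1# - z * z + z * E + z * N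
A-linear = combine
  (solve 9 (λ z a b c d A B N V↑ →
      (⟨ 1 ⟩ :- z :* (z :* (b :+ ⟨ 1 ⟩))) :* A :- (⟨ 1 ⟩ :- z :* z :+ z :* (z :* (b :+ ⟨ 1 ⟩)) :+ z :* N)
      := ⟨ 1 ⟩ :* (A :- (⟨ 1 ⟩ :+ z :* B))
         :+ z :* (B :- (z :* (V↑ :+ ⟨ 0 ⟩) :* A
                       :+ (z :* (a :+ ⟨ 0 ⟩) :* ⟨ 0 ⟩
                       :+ (z :* (b :+ ⟨ 1 ⟩) :* A
                       :+ (z :* (c :+ ⟨ 0 ⟩) :* ⟨ 0 ⟩
                       :+ (z :* (d :+ ⟨ 0 ⟩) :* ⟨ 1 ⟩
                       :+ ⟨ 0 ⟩)))) :+ ⟨ 1 ⟩ :* N))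
         :+ z :* z :* (d :- b) :+ z :* z :* A :* (V↑ :- ⟨ 0 ⟩))
    (λ _ → ≡.refl) z a b c d A B N (v up))
  (vanish 1# A-first-step ⊞ vanish z B-sum ⊞ vanish (z * z) (sym b≈d) ⊞ vanish (z * z * A) v-up)

Aᵈ Aⁿ : FPS
Aᵈ = (1# - z * (1# + X)) * (1# - z * (X - z + z * z * X))
Aⁿ = ((1# - z * z) * (1# - z * (X - κ 2 * z)) + z * (z + z * z * X)) * (1# - z * (1# + X))
     + z * (1# - z * (X - κ 2 * z)) * (1# + z * X - z * z)

A-rational : Aᵈ * A ≈ Aⁿ
A-rational = combine
  (solve 5 (λ z X E N A →
      (⟨ 1 ⟩ :- z :* (⟨ 1 ⟩ :+ X)) :* (⟨ 1 ⟩ :- z :* (X :- z :+ z :* z :* X)) :* A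
        :- (((⟨ 1 ⟩ :- z :* z) :* (⟨ 1 ⟩ :- z :* (X :- ⟨ 2 ⟩ :* z)) :+ z :* (z :+ z :* z :* X))
              :* (⟨ 1 ⟩ :- z :* (⟨ 1 ⟩ :+ X))
            :+ z :* (⟨ 1 ⟩ :- z :* (X :- ⟨ 2 ⟩ :* z)) :* (⟨ 1 ⟩ :+ z :* X :- z :* z))
      := (⟨ 1 ⟩ :- z :* (X :- ⟨ 2 ⟩ :* z)) :* (⟨ 1 ⟩ :- z :* (⟨ 1 ⟩ :+ X))
           :* ((⟨ 1 ⟩ :- z :* E) :* A :- (⟨ 1 ⟩ :- z :* z :+ z :* E :+ z :* N))
         :+ z :* (⟨ 1 ⟩ :- z :* (⟨ 1 ⟩ :+ X)) :* (⟨ 1 ⟩ :+ A)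
           :* ((⟨ 1 ⟩ :- z :* (X :- ⟨ 2 ⟩ :* z)) :* E :- (z :+ z :* z :* X))
         :+ z :* (⟨ 1 ⟩ :- z :* (X :- ⟨ 2 ⟩ :* z))
           :* ((⟨ 1 ⟩ :- z :* (⟨ 1 ⟩ :+ X)) :* N :- (⟨ 1 ⟩ :+ z :* X :- z :* z)))
    (λ _ → ≡.refl) z X E N A)
  (vanish ((1# - z * (X - κ 2 * z)) * (1# - z * (1# + X))) A-linear
   ⊞ vanish (z * (1# - z * (1# + X)) * (1# + A)) E-linear
   ⊞ vanish (z * (1# - z * (X - κ 2 * z))) N-linear)

√Δ : FPS
√Δ = 1# - z * (z + κ 2 * X)

√Δ-square : √Δ * √Δ ≈ 1# - κ 6 * z * z + κ 5 * z * z * z * z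
√Δ-square = combine
  (solve 2 (λ z X →
      (⟨ 1 ⟩ :- z :* (z :+ ⟨ 2 ⟩ :* X)) :* (⟨ 1 ⟩ :- z :* (z :+ ⟨ 2 ⟩ :* X))
        :- (⟨ 1 ⟩ :- ⟨ 6 ⟩ :* z :* z :+ ⟨ 5 ⟩ :* z :* z :* z :* z)
      := ⟨ 4 ⟩ :* z :* (z :* X :* X :+ (z :* z :- ⟨ 1 ⟩) :* X :+ z :- z :* z :* z :- ⟨ 0 ⟩))
    (λ _ → ≡.refl) z X)
  (vanish (κ 4 * z) X-quadratic)

denom′ numer′ : FPS
denom′ = κ 2 * (1# + z * z) * (1# - κ 2 * z - z * z)
numer′ = z * (κ 2 * z * z * z + κ 9 * z * z + κ 4 * z - κ 7) + (z + κ 2) * (κ 2 * z + 1#) * √Δ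

closed-form : denom′ * Aⁿ ≈ Aᵈ * numer′
closed-form = combine
  (solve 2 (λ z X →
      ⟨ 2 ⟩ :* (⟨ 1 ⟩ :+ z :* z) :* (⟨ 1 ⟩ :- ⟨ 2 ⟩ :* z :- z :* z)
        :* (((⟨ 1 ⟩ :- z :* z) :* (⟨ 1 ⟩ :- z :* (X :- ⟨ 2 ⟩ :* z)) :+ z :* (z :+ z :* z :* X))
              :* (⟨ 1 ⟩ :- z :* (⟨ 1 ⟩ :+ X))
            :+ z :* (⟨ 1 ⟩ :- z :* (X :- ⟨ 2 ⟩ :* z)) :* (⟨ 1 ⟩ :+ z :* X :- z :* z))
      :- (⟨ 1 ⟩ :- z :* (⟨ 1 ⟩ :+ X)) :* (⟨ 1 ⟩ :- z :* (X :- z :+ z :* z :* X))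
        :* (z :* (⟨ 2 ⟩ :* z :* z :* z :+ ⟨ 9 ⟩ :* z :* z :+ ⟨ 4 ⟩ :* z :- ⟨ 7 ⟩)
            :+ (z :+ ⟨ 2 ⟩) :* (⟨ 2 ⟩ :* z :+ ⟨ 1 ⟩) :* (⟨ 1 ⟩ :- z :* (z :+ ⟨ 2 ⟩ :* X)))
      := ⟨ 2 ⟩ :* z :* (z :* X :- ⟨ 1 ⟩) :* (⟨ 1 ⟩ :+ z :* z) :* (z :+ ⟨ 2 ⟩) :* (⟨ 2 ⟩ :* z :+ ⟨ 1 ⟩)
           :* (z :* X :* X :+ (z :* z :- ⟨ 1 ⟩) :* X :+ z :- z :* z :* z :- ⟨ 0 ⟩))
    (λ _ → ≡.refl) z X)
  (vanish (κ 2 * z * (z * X - 1#) * (1# + z * z) * (z + κ 2) * (κ 2 * z + 1#)) X-quadratic)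

A-closed-form : denom′ * A ≈ numer′
A-closed-form = *-cancelˡ Aᵈ (≡.cong₂ ℚ._*_ (1-z*-at-0 (1# + X)) (1-z*-at-0 (X - z + z * z * X))) (combine
  (solve 5 (λ D Nu Aᵈ Aⁿ A → Aᵈ :* (D :* A) :- Aᵈ :* Nu := D :* (Aᵈ :* A :- Aⁿ) :+ ⟨ 1 ⟩ :* (D :* Aⁿ :- Aᵈ :* Nu))
    (λ _ → ≡.refl) denom′ numer′ Aᵈ Aⁿ A)
  (vanish denom′ A-rational ⊞ vanish 1# closed-form))

horner : List ℤ → FPS
horner []       = 0#
horner (c ∷ cs) = const (c / 1) + z * horner cs

poly≈horner : ∀ cs → poly cs ≈ horner cs
poly≈horner []       n = ≡.sym (0S≡0 n)
poly≈horner (c ∷ cs) =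
  trans (head-tail {poly (c ∷ cs)} ≡.refl (λ _ → ≡.refl)) (+-congˡ {const (c / 1)} (*-congˡ {z} (poly≈horner cs)))

sqrt≈√Δ : sqrtS (poly (+ 1 ∷ + 0 ∷ -[1+ 5 ] ∷ + 0 ∷ + 5 ∷ [])) ≈ √Δ
sqrt≈√Δ = square-root-unique (≡.cong (1ℚ ℚ.+_) (1-z*-at-0 (z + κ 2 * X))) (begin
  sqrtS Δ * sqrtS Δ                           ≈⟨ sqrtS-spec Δ ≡.refl ⟩
  Δ                                           ≈⟨ poly≈horner (+ 1 ∷ + 0 ∷ -[1+ 5 ] ∷ + 0 ∷ + 5 ∷ []) ⟩
  horner (+ 1 ∷ + 0 ∷ -[1+ 5 ] ∷ + 0 ∷ + 5 ∷ [])
    ≈⟨ solve 1 (λ z → ⟨ 1 ⟩ :+ z :* (⟨ 0 ⟩ :+ z :* (con (-[1+ 5 ] / 1) :+ z :* (⟨ 0 ⟩ :+ z :* (⟨ 5 ⟩ :+ z :* ⟨ 0 ⟩))))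
                      := ⟨ 1 ⟩ :- ⟨ 6 ⟩ :* z :* z :+ ⟨ 5 ⟩ :* z :* z :* z :* z) (λ _ → ≡.refl) z ⟩
  1# - κ 6 * z * z + κ 5 * z * z * z * z      ≈⟨ √Δ-square ⟨
  √Δ * √Δ                                     ∎)
  where Δ = poly (+ 1 ∷ + 0 ∷ -[1+ 5 ] ∷ + 0 ∷ + 5 ∷ [])

denom≈denom′ : denom ≈ denom′
denom≈denom′ = begin
  denom
    ≈⟨ *-cong (*-cong (poly≈horner (+ 2 ∷ [])) (poly≈horner (+ 1 ∷ + 0 ∷ + 1 ∷ [])))
              (poly≈horner (+ 1 ∷ -[1+ 1 ] ∷ -[1+ 0 ] ∷ [])) ⟩
  horner (+ 2 ∷ []) * horner (+ 1 ∷ + 0 ∷ + 1 ∷ []) * horner (+ 1 ∷ -[1+ 1 ] ∷ -[1+ 0 ] ∷ [])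
    ≈⟨ solve 1 (λ z → (⟨ 2 ⟩ :+ z :* ⟨ 0 ⟩) :* (⟨ 1 ⟩ :+ z :* (⟨ 0 ⟩ :+ z :* (⟨ 1 ⟩ :+ z :* ⟨ 0 ⟩)))
                      :* (⟨ 1 ⟩ :+ z :* (con (-[1+ 1 ] / 1) :+ z :* (con (-[1+ 0 ] / 1) :+ z :* ⟨ 0 ⟩)))
                    := ⟨ 2 ⟩ :* (⟨ 1 ⟩ :+ z :* z) :* (⟨ 1 ⟩ :- ⟨ 2 ⟩ :* z :- z :* z)) (λ _ → ≡.refl) z ⟩
  denom′ ∎

numer≈numer′ : numer ≈ numer′
numer≈numer′ = begin
  numer
    ≈⟨ +-cong (*-congˡ {z} (poly≈horner (-[1+ 6 ] ∷ + 4 ∷ + 9 ∷ + 2 ∷ [])))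
              (*-cong (*-cong (poly≈horner (+ 2 ∷ + 1 ∷ [])) (poly≈horner (+ 1 ∷ + 2 ∷ []))) sqrt≈√Δ) ⟩
  z * horner (-[1+ 6 ] ∷ + 4 ∷ + 9 ∷ + 2 ∷ []) + horner (+ 2 ∷ + 1 ∷ []) * horner (+ 1 ∷ + 2 ∷ []) * √Δ
    ≈⟨ solve 2 (λ z S → z :* (con (-[1+ 6 ] / 1) :+ z :* (⟨ 4 ⟩ :+ z :* (⟨ 9 ⟩ :+ z :* (⟨ 2 ⟩ :+ z :* ⟨ 0 ⟩))))
                        :+ (⟨ 2 ⟩ :+ z :* (⟨ 1 ⟩ :+ z :* ⟨ 0 ⟩)) :* (⟨ 1 ⟩ :+ z :* (⟨ 2 ⟩ :+ z :* ⟨ 0 ⟩)) :* S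
                      := z :* (⟨ 2 ⟩ :* z :* z :* z :+ ⟨ 9 ⟩ :* z :* z :+ ⟨ 4 ⟩ :* z :- ⟨ 7 ⟩)
                         :+ (z :+ ⟨ 2 ⟩) :* (⟨ 2 ⟩ :* z :+ ⟨ 1 ⟩) :* S) (λ _ → ≡.refl) z √Δ ⟩
  numer′ ∎

rhs≈A : rhs ≈ A
rhs≈A = *-cancelˡ denom′ ≡.refl (begin
  denom′ * rhs   ≈⟨ *-congʳ {rhs} denom≈denom′ ⟨
  denom * rhs    ≈⟨ divS-spec numer denom ⟩
  numer          ≈⟨ numer≈numer′ ⟩
  numer′         ≈⟨ A-closed-form ⟨
  denom′ * A     ∎)

mainTheorem5 : ∀ n → countS n ≡ rhs n
mainTheorem5 n = ≡.trans (countS≗gf n) (≡.trans (gf-cong admissible≡accept n) (≡.sym (rhs≈A n)))
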